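{- Let $H$ be a 3-graph with an even number $n$ of vertices, and let $D$ be the digraph obtained from $H$ by Procedure 3 (for some fixed outcome of the permutation). If $C_1,C_2$ are edge-disjoint directed Hamilton cycles in $D$, then their associated tight Hamilton cycles $C_1',C_2'$ in $H$ are edge-disjoint.
   Context: A 3-graph is a 3-uniform hypergraph. Procedure 3 on a 3-graph $H$ with $n$ vertices, $n$ even: (1) take a uniformly random ordering $v_1,\dots,v_n$ of the vertices and split it into the $n/2$ ordered pairs $(v_1,v_2),(v_3,v_4),\dots,(v_{n-1},v_n)$. (2) $D$ is the digraph whose $n/2$ vertices are these pairs, with a directed edge from $(v_i,v_{i+1})$ to $(v_j,v_{j+1})$ iff both $\{v_i,v_{i+1},v_j\}$ and $\{v_{i+1},v_j,v_{j+1}\}$ are edges of $H$. The tight Hamilton cycle in $H$ associated with a directed Hamilton cycle $C$ of $D$ is the set of all hyperedges $\{v_i,v_{i+1},v_j\},\{v_{i+1},v_j,v_{j+1}\}$ over the directed edges from $(v_i,v_{i+1})$ to $(v_j,v_{j+1})$ of $C$. (A tight Hamilton cycle in an $n$-vertex 3-graph is a set of $n$ edges for which there is an ordering $u_1,\dots,u_n$ of all vertices such that every triple $\{u_i,u_{i+1},u_{i+2}\}$, indices mod $n$, is in the set.) -}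

module Defs where

open import Data.Nat using (ℕ; zero; suc; _*_)
open import Data.Nat.DivMod using (_mod_)
open import Data.Fin using (Fin; zero; suc; toℕ; combine)
open import Data.Fin.Subset using (Subset; ⁅_⁆; _∪_; ∣_∣)
open import Data.Fin.Permutation using (Permutation′; _⟨$⟩ʳ_)
open import Data.Product using (Σ; ∃; _×_; _,_)
open import Data.Sum using (_⊎_)
open import Relation.Nullary using (¬_)
open import Relation.Binary.PropositionalEquality using (_≡_)

triple : ∀ {n} → Fin n → Fin n → Fin n → Subset n
triple a b c = ⁅ a ⁆ ∪ (⁅ b ⁆ ∪ ⁅ c ⁆)

record ThreeGraph (n : ℕ) : Set₁ where
  field
    IsEdge  : Subset n → Set
    uniform : ∀ e → IsEdge e → ∣ e ∣ ≡ 3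
open ThreeGraph public

next : ∀ {m} → Fin m → Fin m
next {suc m} i = suc (toℕ i) mod (suc m)

-- Procedure 3.  The vertex ordering v_0,...,v_{2m-1} is given by a permutation σ of
-- Fin (m * 2): v_i = σ(i).  Pair k (k : Fin m) is (v_{2k}, v_{2k+1}).
module Procedure3 {m : ℕ} (H : ThreeGraph (m * 2)) (σ : Permutation′ (m * 2)) where

  fst : Fin m → Fin (m * 2)
  fst k = σ ⟨$⟩ʳ combine k zero

  snd : Fin m → Fin (m * 2)
  snd k = σ ⟨$⟩ʳ combine k (suc zero)

  edgeA : Fin m → Fin m → Subset (m * 2)
  edgeA k l = triple (fst k) (snd k) (fst l)

  edgeB : Fin m → Fin m → Subset (m * 2)
  edgeB k l = triple (snd k) (fst l) (snd l)

  Arc : Fin m → Fin m → Set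
  Arc k l = IsEdge H (edgeA k l) × IsEdge H (edgeB k l)

  record HamCycle : Set where
    field
      π    : Permutation′ m
      arcs : ∀ i → Arc (π ⟨$⟩ʳ i) (π ⟨$⟩ʳ next i)

  open HamCycle public

  InCycle : HamCycle → Fin m → Fin m → Set
  InCycle C k l = ∃ λ i → (π C ⟨$⟩ʳ i ≡ k) × (π C ⟨$⟩ʳ next i ≡ l)

  EdgeDisjoint : HamCycle → HamCycle → Set
  EdgeDisjoint C₁ C₂ = ∀ k l → ¬ (InCycle C₁ k l × InCycle C₂ k l)

  InTight : HamCycle → Subset (m * 2) → Set
  InTight C e = ∃ λ k → ∃ λ l → InCycle C k l × ((e ≡ edgeA k l) ⊎ (e ≡ edgeB k l))

  TightEdgeDisjoint : HamCycle → HamCycle → Set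
  TightEdgeDisjoint C₁ C₂ = ∀ e → ¬ (InTight C₁ e × InTight C₂ e)

module Submission where

-- Every hyperedge contributed by an arc k → l of D has the shape
--   A(k,l) = {fst k, snd k, fst l}   or   B(k,l) = {snd k, fst l, snd l},
-- where fst, snd label the two vertices of each pair.  Since σ is a
-- bijection, fst and snd are injective with disjoint images, so from a
-- vertex of such a triple one can read off which pair it belongs to and in
-- which position.  Comparing the members of two such triples shows that the
-- triple determines its arc: if A(k,l), B(k,l) and A(k',l'), B(k',l') share a
-- set then k = k' and l = l'.  Hence a hyperedge lying in both C₁' and C₂'
-- comes from an arc lying in both C₁ and C₂, which edge-disjointness forbids.

open import Defs
open import Data.Nat using (ℕ; _*_)
open import Data.Fin using (Fin; combine)
open import Data.Fin.Subset using (Subset; _∈_; ⁅_⁆; _∪_)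
open import Data.Fin.Subset.Properties using (x∈⁅x⁆; x∈⁅y⁆⇒x≡y; x∈p∪q⁻; x∈p∪q⁺)
open import Data.Fin.Properties using (combine-injective)
open import Data.Fin.Permutation using (Permutation′; _⟨$⟩ʳ_)
open import Function.Bundles using (Injection)
open import Function.Properties.Inverse using (↔⇒↣)
open import Data.Product using (_×_; _,_; proj₁)
open import Data.Sum using (_⊎_; inj₁; inj₂; swap)
open import Data.Empty using (⊥-elim)
open import Relation.Binary.PropositionalEquality using (_≡_; _≢_; refl; sym; trans; subst)

module _ {n : ℕ} where

  ∈-triple⁻ : ∀ {a b c x : Fin n} → x ∈ triple a b c → x ≡ a ⊎ (x ≡ b ⊎ x ≡ c)
  ∈-triple⁻ {a} {b} {c} x∈abc with x∈p∪q⁻ ⁅ a ⁆ (⁅ b ⁆ ∪ ⁅ c ⁆) x∈abc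
  ... | inj₁ x∈a = inj₁ (x∈⁅y⁆⇒x≡y a x∈a)
  ... | inj₂ x∈bc with x∈p∪q⁻ ⁅ b ⁆ ⁅ c ⁆ x∈bc
  ...   | inj₁ x∈b = inj₂ (inj₁ (x∈⁅y⁆⇒x≡y b x∈b))
  ...   | inj₂ x∈c = inj₂ (inj₂ (x∈⁅y⁆⇒x≡y c x∈c))

  ∈-triple₁ : ∀ (a b c : Fin n) → a ∈ triple a b c
  ∈-triple₁ a b c = x∈p∪q⁺ (inj₁ (x∈⁅x⁆ a))

  ∈-triple₂ : ∀ (a b c : Fin n) → b ∈ triple a b c
  ∈-triple₂ a b c = x∈p∪q⁺ (inj₂ (x∈p∪q⁺ (inj₁ (x∈⁅x⁆ b))))

  ∈-triple₃ : ∀ (a b c : Fin n) → c ∈ triple a b c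
  ∈-triple₃ a b c = x∈p∪q⁺ (inj₂ (x∈p∪q⁺ (inj₂ (x∈⁅x⁆ c))))

mutual-choice : ∀ {A : Set} {a b c : A} → a ≡ c ⊎ a ≡ b → b ≡ c ⊎ b ≡ a → a ≡ b
mutual-choice (inj₂ a≡b) _          = a≡b
mutual-choice (inj₁ _)   (inj₂ b≡a) = sym b≡a
mutual-choice (inj₁ a≡c) (inj₁ b≡c) = trans a≡c (sym b≡c)

module Pairing {I : Set} {n : ℕ} (fst snd : I → Fin n)
               (fst-injective : ∀ {j k} → fst j ≡ fst k → j ≡ k)
               (snd-injective : ∀ {j k} → snd j ≡ snd k → j ≡ k)
               (fst≢snd : ∀ {j k} → fst j ≢ snd k) where

  edgeA : I → I → Subset n
  edgeA k l = triple (fst k) (snd k) (fst l)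

  edgeB : I → I → Subset n
  edgeB k l = triple (snd k) (fst l) (snd l)

  fst∈edgeA : ∀ {j} k l → fst j ∈ edgeA k l → j ≡ k ⊎ j ≡ l
  fst∈edgeA k l x∈e with ∈-triple⁻ x∈e
  ... | inj₁ eq          = inj₁ (fst-injective eq)
  ... | inj₂ (inj₁ eq)   = ⊥-elim (fst≢snd eq)
  ... | inj₂ (inj₂ eq)   = inj₂ (fst-injective eq)

  snd∈edgeA : ∀ {j} k l → snd j ∈ edgeA k l → j ≡ k
  snd∈edgeA k l x∈e with ∈-triple⁻ x∈e
  ... | inj₁ eq          = ⊥-elim (fst≢snd (sym eq))
  ... | inj₂ (inj₁ eq)   = snd-injective eq
  ... | inj₂ (inj₂ eq)   = ⊥-elim (fst≢snd (sym eq))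

  fst∈edgeB : ∀ {j} k l → fst j ∈ edgeB k l → j ≡ l
  fst∈edgeB k l x∈e with ∈-triple⁻ x∈e
  ... | inj₁ eq          = ⊥-elim (fst≢snd eq)
  ... | inj₂ (inj₁ eq)   = fst-injective eq
  ... | inj₂ (inj₂ eq)   = ⊥-elim (fst≢snd eq)

  snd∈edgeB : ∀ {j} k l → snd j ∈ edgeB k l → j ≡ k ⊎ j ≡ l
  snd∈edgeB k l x∈e with ∈-triple⁻ x∈e
  ... | inj₁ eq          = inj₁ (snd-injective eq)
  ... | inj₂ (inj₁ eq)   = ⊥-elim (fst≢snd (sym eq))
  ... | inj₂ (inj₂ eq)   = inj₂ (snd-injective eq)

  -- Each triple determines its arc.  The pair k of edgeA k l is the unique one
  -- contributing its second vertex; l is then pinned down by the first vertices.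
  edgeA-determines : ∀ {k l k' l'} → edgeA k l ≡ edgeA k' l' → k ≡ k' × l ≡ l'
  edgeA-determines {k} {l} {k'} {l'} eq
    with refl ← snd∈edgeA k' l' (subst (snd k ∈_) eq (∈-triple₂ (fst k) (snd k) (fst l)))
    = refl , mutual-choice
        (fst∈edgeA k l' (subst (fst l ∈_) eq (∈-triple₃ (fst k) (snd k) (fst l))))
        (fst∈edgeA k l (subst (fst l' ∈_) (sym eq) (∈-triple₃ (fst k) (snd k) (fst l'))))

  -- The pair l of edgeB k l is the unique one contributing its first vertex.
  edgeB-determines : ∀ {k l k' l'} → edgeB k l ≡ edgeB k' l' → k ≡ k' × l ≡ l'
  edgeB-determines {k} {l} {k'} {l'} eq
    with refl ← fst∈edgeB k' l' (subst (fst l ∈_) eq (∈-triple₂ (snd k) (fst l) (snd l)))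
    = mutual-choice
        (swap (snd∈edgeB k' l (subst (snd k ∈_) eq (∈-triple₁ (snd k) (fst l) (snd l)))))
        (swap (snd∈edgeB k l (subst (snd k' ∈_) (sym eq) (∈-triple₁ (snd k') (fst l) (snd l)))))
      , refl

  -- A triple of type A can equal one of type B only when k = l = k' = l'
  -- (a loop); the two arcs then coincide.
  edgeA≡edgeB-determines : ∀ {k l k' l'} → edgeA k l ≡ edgeB k' l' → k ≡ k' × l ≡ l'
  edgeA≡edgeB-determines {k} {l} {k'} {l'} eq =
    sym (snd∈edgeA k l (subst (snd k' ∈_) (sym eq) (∈-triple₁ (snd k') (fst l') (snd l'))))
    , fst∈edgeB k' l' (subst (fst l ∈_) eq (∈-triple₃ (fst k) (snd k) (fst l)))

  TripleOf : Subset n → I → I → Set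
  TripleOf e k l = e ≡ edgeA k l ⊎ e ≡ edgeB k l

  triple-determines-arc : ∀ {e} k l k' l' → TripleOf e k l → TripleOf e k' l' →
                          k ≡ k' × l ≡ l'
  triple-determines-arc _ _ _ _ (inj₁ refl) (inj₁ eq) = edgeA-determines eq
  triple-determines-arc _ _ _ _ (inj₁ refl) (inj₂ eq) = edgeA≡edgeB-determines eq
  triple-determines-arc _ _ _ _ (inj₂ refl) (inj₁ eq)
    with refl , refl ← edgeA≡edgeB-determines (sym eq) = refl , refl
  triple-determines-arc _ _ _ _ (inj₂ refl) (inj₂ eq) = edgeB-determines eq

module Procedure3Pairing {m : ℕ} (H : ThreeGraph (m * 2)) (σ : Permutation′ (m * 2)) where
  open Procedure3 {m} H σ

  position-injective : ∀ {k k' : Fin m} {b b' : Fin 2} →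
                       σ ⟨$⟩ʳ combine k b ≡ σ ⟨$⟩ʳ combine k' b' →
                       k ≡ k' × b ≡ b'
  position-injective {k} {k'} {b} {b'} eq =
    combine-injective k b k' b' (Injection.injective (↔⇒↣ σ) eq)

  fst-injective : ∀ {j k} → fst j ≡ fst k → j ≡ k
  fst-injective eq = proj₁ (position-injective eq)

  snd-injective : ∀ {j k} → snd j ≡ snd k → j ≡ k
  snd-injective eq = proj₁ (position-injective eq)

  fst≢snd : ∀ {j k} → fst j ≢ snd k
  fst≢snd eq with position-injective eq
  ... | _ , ()

  open Pairing fst snd fst-injective snd-injective fst≢snd public
    using (triple-determines-arc)

lemma4p1 : (m : ℕ) (H : ThreeGraph (m * 2)) (σ : Permutation′ (m * 2))
           (C₁ C₂ : Procedure3.HamCycle {m} H σ) →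
           Procedure3.EdgeDisjoint {m} H σ C₁ C₂ →
           Procedure3.TightEdgeDisjoint {m} H σ C₁ C₂
lemma4p1 m H σ C₁ C₂ disjoint e ((k , l , k→l∈C₁ , e-of-kl) , (k' , l' , k'→l'∈C₂ , e-of-k'l'))
  with refl , refl ← Procedure3Pairing.triple-determines-arc H σ k l k' l' e-of-kl e-of-k'l'
  = disjoint k l (k→l∈C₁ , k'→l'∈C₂)
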